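{- Let $G$ be a finite connected loopless graph with edge lengths $\ell$, $H$ its subdivision, and $D$ a $G$-admissible divisor on $H$. Then for each vertex $v$ of $G$, the divisor $M_v(D)$ is $G$-admissible, and $M_v(D)=D+\operatorname{div}_\ell(\chi_v;D)$.
   Context: $G$ is a finite connected loopless graph with lengths $\ell:E\to\mathbb{Z}_{>0}$; $H$ is obtained by replacing each oriented edge $e=uv$ of $G$ (tail $u$, head $v$) by a path $u\,x^e_1\cdots x^e_{\ell_e-1}\,v$, with $x^e_0=u$. For $F\colon V(H)\to\mathbb{Z}$, $\operatorname{div}(F)(w)=\sum(F(w')-F(w))$ over edges of $H$ at $w$ with other endpoint $w'$. A divisor $D$ on $H$ is $G$-admissible if for each oriented edge $e$ of $G$, $D(x^e_j)$ ($1\le j\le\ell_e-1$) is $0$ except for at most one $j$ where it is $1$. For a divisor $D$ and $f\colon V(G)\to\mathbb{Z}$, the canonical extension $\widetilde f$ is the unique extension of $f$ to $V(H)$ with $D+\operatorname{div}(\widetilde f)$ $G$-admissible, and $\operatorname{div}_\ell(f;D)=\operatorname{div}(\widetilde f)$. $\chi_v\colon V(G)\to\mathbb{Z}$ is the characteristic function of $v$. For $D$ $G$-admissible and $v\in V(G)$: for each oriented edge $e$ with tail $v$, $j_e(v)=j$ if $D(x^e_j)=1$ for some $j\in\{1,\dots,\ell_e-1\}$, and $j_e(v)=0$ otherwise; $C_v\subseteq V(H)$ is the set of all $x^e_i$ with $0\le i\le j_e(v)$, over all oriented edges $e$ with tail $v$; and $M_v(D):=D+\operatorname{div}(\chi_{C_v})$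 (the divisor obtained from $D$ when all vertices of $C_v$ fire), where $\chi_{C_v}$ is the characteristic function of $C_v$ on $V(H)$. -}

module Defs where

open import Data.Nat as ℕ using (ℕ; zero; suc; _≤_; _<_; _∸_)
open import Data.Nat.Properties using (_<?_)
open import Data.Fin using (Fin; fromℕ<)
open import Data.Fin.Properties using () renaming (_≟_ to _≟ᶠ_)
open import Data.Integer as ℤ using (ℤ; 0ℤ; 1ℤ; _+_; _-_)
open import Data.Bool using (Bool; true; false; if_then_else_; _∨_)
open import Data.List using (List; []; _∷_; concatMap; upTo; allFin; foldr)
open import Data.Bool.ListAction using (any)
open import Data.Product using (Σ; _,_; _×_; ∃; proj₁)
open import Data.Sum using (_⊎_; inj₁; inj₂)
import Data.Sum.Properties as SumP
import Data.Product.Properties as ProdP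
open import Relation.Binary.PropositionalEquality using (_≡_; _≢_)
open import Relation.Binary.Definitions using (DecidableEquality)
open import Relation.Binary.Construct.Closure.ReflexiveTransitive using (Star)
open import Relation.Nullary.Decidable using (⌊_⌋)

-- A finite loopless multigraph G: vertices Fin n, edges Fin m, each edge e
-- carrying a fixed reference orientation src e → tgt e.
record Graph : Set where
  field
    n m      : ℕ
    src tgt  : Fin m → Fin n
    loopless : ∀ e → src e ≢ tgt e

Adj : (G : Graph) → Fin (Graph.n G) → Fin (Graph.n G) → Set
Adj G u v = ∃ λ e → (src e ≡ u × tgt e ≡ v) ⊎ (src e ≡ v × tgt e ≡ u)
  where open Graph G

Connected : Graph → Set
Connected G = ∀ u v → Star (Adj G) u v

module Subdivision (G : Graph) (ℓ : Fin (Graph.m G) → ℕ) where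
  open Graph G

  -- Vertices of H: vertices of G, plus interior points of each edge e:
  -- (e , k) with k : Fin (ℓ e ∸ 1) stands for x^e_{k+1} (reference orientation).
  HV : Set
  HV = Fin n ⊎ Σ (Fin m) (λ e → Fin (ℓ e ∸ 1))

  _≟H_ : DecidableEquality HV
  _≟H_ = SumP.≡-dec _≟ᶠ_ (ProdP.≡-dec _≟ᶠ_ _≟ᶠ_)

  _==_ : HV → HV → Bool
  a == b = ⌊ a ≟H b ⌋

  -- pos e i = x^e_i along the reference orientation (0 = src e, ℓ e = tgt e)
  pos : (e : Fin m) → ℕ → HV
  pos e zero = inj₁ (src e)
  pos e (suc k) with k <? (ℓ e ∸ 1)
  ... | Relation.Nullary.Decidable.yes p = inj₂ (e , fromℕ< p)
  ... | Relation.Nullary.Decidable.no _  = inj₁ (tgt e)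

  HEdges : List (HV × HV)
  HEdges = concatMap (λ e → Data.List.map (λ i → (pos e i , pos e (suc i))) (upTo (ℓ e))) (allFin m)

  Divisor : Set
  Divisor = HV → ℤ

  div : (HV → ℤ) → Divisor
  div F w = foldr (λ { (a , b) s →
                (if w == a then F b - F a else 0ℤ) + ((if w == b then F a - F b else 0ℤ) + s) })
              0ℤ HEdges

  -- oriented edges of G: (e , true) = reference orientation, (e , false) = reverse
  OEdge : Set
  OEdge = Fin m × Bool

  len : OEdge → ℕ
  len (e , _) = ℓ e

  tailO : OEdge → Fin n
  tailO (e , true)  = src e
  tailO (e , false) = tgt e

  x : OEdge → ℕ → HV
  x (e , true)  j = pos e j
  x (e , false) j = pos e (ℓ e ∸ j)

  Admissible : Divisor → Set
  Admissible D =
    (∀ o j → 1 ≤ j → j < len o → D (x o j) ≡ 0ℤ ⊎ D (x o j) ≡ 1ℤ) ×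
    (∀ o j j' → 1 ≤ j → j < len o → 1 ≤ j' → j' < len o →
       D (x o j) ≡ 1ℤ → D (x o j') ≡ 1ℤ → j ≡ j')

  firstOr0 : (ℕ → Bool) → List ℕ → ℕ
  firstOr0 p [] = 0
  firstOr0 p (j ∷ js) = if p j then j else firstOr0 p js

  -- j_o(v): the j ∈ {1,…,ℓ_o - 1} with D(x^o_j) = 1, or 0 if there is none
  jO : Divisor → OEdge → ℕ
  jO D o = firstOr0 (λ j → ⌊ D (x o j) ℤ.≟ 1ℤ ⌋)
                    (Data.List.map suc (upTo (len o ∸ 1)))

  allOEdges : List OEdge
  allOEdges = concatMap (λ e → (e , true) ∷ (e , false) ∷ []) (allFin m)

  inC : Divisor → Fin n → HV → Bool
  inC D v w = any (λ o → ⌊ tailO o ≟ᶠ v ⌋ Data.Bool.∧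
                          any (λ i → w == x o i) (upTo (suc (jO D o))))
                  allOEdges

  χC : Divisor → Fin n → HV → ℤ
  χC D v w = if inC D v w then 1ℤ else 0ℤ

  M : Divisor → Fin n → Divisor
  M D v w = D w + div (χC D v) w

  χ : Fin n → Fin n → ℤ
  χ v u = if ⌊ u ≟ᶠ v ⌋ then 1ℤ else 0ℤ

  Extends : (HV → ℤ) → (Fin n → ℤ) → Set
  Extends F f = ∀ u → F (inj₁ u) ≡ f u

module Submission where

-- Let o = (x₀ = v, x₁, …, x_L) be an oriented edge with tail v, and let x_J carry the chip of D on o
-- (J = 0 if there is none).  Then C_v ∩ o = {x₀, …, x_J}, and on a path the divergence of the
-- indicator of {0, …, J} is δ_{J+1} − δ_J: firing C_v moves that chip one step forward and changes
-- nothing on edges away from v, so M_v(D) is admissible.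
-- For the second claim, χ_{C_v} and any extension F of χ_v with D + div F admissible agree at both
-- ends of every edge, while D + div(·) is some δ_a, resp. δ_b, inside it.  The difference h vanishes
-- at the ends and div h = δ_a − δ_b, so summation by parts against the weights L − j gives
-- L·h(x₁) = w(b) − w(a) with 0 ≤ w(·) < L.  Hence h(x₁) = 0 and a = b, so h is harmonic with zero
-- initial values and vanishes; as div only sees values along edges, div χ_{C_v} = div F.


open import Data.Bool.ListAction using (any)
open import Data.Bool using (Bool; true; false; T; not; if_then_else_; _∧_)
open import Data.Bool.Properties using (T-∧)
open import Data.Empty using (⊥-elim)
open import Data.Fin using (Fin; toℕ)
open import Data.Fin.Properties using (toℕ-fromℕ<) renaming (_≟_ to _≟ᶠ_)
open import Data.Integer as ℤ using (ℤ; 0ℤ; 1ℤ; _+_; _-_; _*_; ∣_∣)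
import Data.Integer.Properties as ℤ
open import Data.Integer.Tactic.RingSolver using (solve-∀)
open import Data.List using (List; []; _∷_; _++_; [_]; map; concat; foldr; applyUpTo; upTo; allFin)
open import Data.List.Membership.Propositional using (_∈_; lose; find)
open import Data.List.Membership.Propositional.Properties
  using (∈-allFin; ∈-upTo⁺; ∈-upTo⁻; ∈-applyUpTo⁺; ∈-applyUpTo⁻; ∈-map⁺; ∈-map⁻; ∈-concat⁺′)
open import Data.List.Relation.Unary.All as All using (All)
open import Data.List.Relation.Unary.Any using (here; there)
open import Data.List.Relation.Unary.Any.Properties using (any⁺; any⁻)
open import Data.List.Relation.Unary.AllPairs using (_∷_)
open import Data.List.Relation.Unary.Unique.Propositional using (Unique)
open import Data.List.Relation.Unary.Unique.Propositional.Properties using (allFin⁺; upTo⁺; applyUpTo⁺₁)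
open import Data.List.Properties using (applyUpTo-∷ʳ)
open import Data.Nat as ℕ using (ℕ; zero; suc; pred; _≤_; _<_; _∸_; z≤n; s≤s)
import Data.Nat.Properties as ℕ
open import Data.Nat.Properties using (_<?_)
open import Data.Product using (∃; ∃₂; _×_; _,_; proj₁; proj₂)
open import Data.Sum as Sum using (_⊎_; inj₁; inj₂)
open import Data.Sum.Properties using (inj₁-injective)
open import Function using (_∘_; Equivalence)
open import Relation.Binary.PropositionalEquality using (_≡_; _≢_; refl; sym; trans; cong; cong₂; subst; module ≡-Reasoning)
open import Relation.Nullary using (¬_; yes; no)
open import Relation.Nullary.Decidable using (⌊_⌋; toWitness; fromWitness)
open import Relation.Binary.Definitions using (tri<; tri≈; tri>)

open import Defs

∑ : {A : Set} → (A → ℤ) → List A → ℤ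
∑ φ []       = 0ℤ
∑ φ (a ∷ as) = φ a + ∑ φ as

module _ {A : Set} where

  ∑-++ : (φ : A → ℤ) (xs ys : List A) → ∑ φ (xs ++ ys) ≡ ∑ φ xs + ∑ φ ys
  ∑-++ φ []       ys = sym (ℤ.+-identityˡ _)
  ∑-++ φ (x ∷ xs) ys = trans (cong (φ x +_) (∑-++ φ xs ys)) (sym (ℤ.+-assoc (φ x) _ _))

  ∑-cong : {φ ψ : A → ℤ} {xs : List A} → (∀ {a} → a ∈ xs → φ a ≡ ψ a) → ∑ φ xs ≡ ∑ ψ xs
  ∑-cong {xs = []}     eq = refl
  ∑-cong {xs = x ∷ xs} eq = cong₂ _+_ (eq (here refl)) (∑-cong (eq ∘ there))

  ∑-zero : {φ : A → ℤ} {xs : List A} → (∀ {a} → a ∈ xs → φ a ≡ 0ℤ) → ∑ φ xs ≡ 0ℤ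
  ∑-zero {xs = []}     eq = refl
  ∑-zero {xs = x ∷ xs} eq = cong₂ _+_ (eq (here refl)) (∑-zero (eq ∘ there))

  ∑-single : {φ : A → ℤ} {xs : List A} {y : A} → Unique xs → y ∈ xs →
             (∀ a → φ a ≡ 0ℤ ⊎ a ≡ y) → ∑ φ xs ≡ φ y
  ∑-single {φ} {y ∷ xs} (y∉xs ∷ _) (here refl) supp =
    trans (cong (φ y +_) (∑-zero vanish)) (ℤ.+-identityʳ _)
    where
    vanish : ∀ {a} → a ∈ xs → φ a ≡ 0ℤ
    vanish {a} a∈xs with supp a
    ... | inj₁ φa≡0 = φa≡0
    ... | inj₂ refl = ⊥-elim (All.lookup y∉xs a∈xs refl)
  ∑-single {φ} {x ∷ xs} (x∉xs ∷ unique) (there y∈xs) supp with supp x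
  ... | inj₁ φx≡0 = trans (cong (_+ ∑ φ xs) φx≡0) (trans (ℤ.+-identityˡ _) (∑-single unique y∈xs supp))
  ... | inj₂ refl = ⊥-elim (All.lookup x∉xs y∈xs refl)

  ∑-- : (φ ψ : A → ℤ) (xs : List A) → ∑ (λ a → φ a - ψ a) xs ≡ ∑ φ xs - ∑ ψ xs
  ∑-- φ ψ []       = refl
  ∑-- φ ψ (x ∷ xs) = trans (cong (φ x - ψ x +_) (∑-- φ ψ xs)) (interchange (φ x) (ψ x) (∑ φ xs) (∑ ψ xs))
    where
    interchange : ∀ a b c d → (a - b) + (c - d) ≡ (a + c) - (b + d)
    interchange = solve-∀

module _ {A B : Set} where

  ∑-map : (φ : A → ℤ) (f : B → A) (xs : List B) → ∑ φ (map f xs) ≡ ∑ (φ ∘ f) xs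
  ∑-map φ f []       = refl
  ∑-map φ f (x ∷ xs) = cong (φ (f x) +_) (∑-map φ f xs)

  ∑-concat-map : (φ : A → ℤ) (g : B → List A) (xs : List B) →
                 ∑ φ (concat (map g xs)) ≡ ∑ (∑ φ ∘ g) xs
  ∑-concat-map φ g []       = refl
  ∑-concat-map φ g (x ∷ xs) = trans (∑-++ φ (g x) _) (cong (∑ φ (g x) +_) (∑-concat-map φ g xs))

foldr≡∑+∑ : {A : Set} (φ ψ : A → ℤ) (xs : List A) →
            foldr (λ a s → φ a + (ψ a + s)) 0ℤ xs ≡ ∑ φ xs + ∑ ψ xs
foldr≡∑+∑ φ ψ []       = refl
foldr≡∑+∑ φ ψ (x ∷ xs) =
  trans (cong (λ s → φ x + (ψ x + s)) (foldr≡∑+∑ φ ψ xs)) (interchange (φ x) (ψ x) (∑ φ xs) (∑ ψ xs))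
  where
  interchange : ∀ a b c d → a + (b + (c + d)) ≡ (a + c) + (b + d)
  interchange = solve-∀

-- Chip firing on a path 0 — 1 — ⋯ — L

-- Only meaningful for j ≥ 1, since pred 0 = 0.
pathDiv : (ℕ → ℤ) → ℕ → ℤ
pathDiv g j = (g (pred j) - g j) + (g (suc j) - g j)

δ : ℕ → ℕ → ℤ
δ a j = if ⌊ j ℕ.≟ a ⌋ then 1ℤ else 0ℤ

χ≤ : ℕ → ℕ → ℤ
χ≤ J i = if ⌊ i ℕ.≤? J ⌋ then 1ℤ else 0ℤ

δ-≡ : ∀ a → δ a a ≡ 1ℤ
δ-≡ a with a ℕ.≟ a
... | yes _   = refl
... | no a≢a = ⊥-elim (a≢a refl)

δ-≢ : ∀ {a j} → j ≢ a → δ a j ≡ 0ℤ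
δ-≢ {a} {j} j≢a with j ℕ.≟ a
... | yes j≡a = ⊥-elim (j≢a j≡a)
... | no _    = refl

δ-≡1 : ∀ {a j} → δ a j ≡ 1ℤ → j ≡ a
δ-≡1 {a} {j} eq with j ℕ.≟ a
... | yes j≡a = j≡a

χ≤-≤ : ∀ {J i} → i ≤ J → χ≤ J i ≡ 1ℤ
χ≤-≤ {J} {i} i≤J with i ℕ.≤? J
... | yes _   = refl
... | no i≰J = ⊥-elim (i≰J i≤J)

χ≤-> : ∀ {J i} → J < i → χ≤ J i ≡ 0ℤ
χ≤-> {J} {i} J<i with i ℕ.≤? J
... | yes i≤J = ⊥-elim (ℕ.<⇒≱ J<i i≤J)
... | no _    = refl

pathDiv-χ≤ : ∀ J j → 1 ≤ j → pathDiv (χ≤ J) j ≡ δ (suc J) j - δ J j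
pathDiv-χ≤ J (suc k) _ with ℕ.<-cmp (suc k) J
... | tri< k+1<J _ _
  rewrite χ≤-≤ (ℕ.<⇒≤ (ℕ.<-trans (ℕ.n<1+n k) k+1<J)) | χ≤-≤ (ℕ.<⇒≤ k+1<J) | χ≤-≤ k+1<J
        | δ-≢ {suc J} (ℕ.<⇒≢ (ℕ.m<n⇒m<1+n k+1<J)) | δ-≢ {J} (ℕ.<⇒≢ k+1<J) = refl
... | tri≈ _ refl _
  rewrite χ≤-≤ (ℕ.n≤1+n k) | χ≤-≤ (ℕ.≤-refl {suc k}) | χ≤-> (ℕ.n<1+n (suc k))
        | δ-≢ {suc (suc k)} (ℕ.1+n≢n ∘ sym) | δ-≡ (suc k) = refl
... | tri> _ _ J<k+1 with ℕ.m≤n⇒m<n∨m≡n (ℕ.≤-pred J<k+1)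
...   | inj₂ refl
  rewrite χ≤-≤ (ℕ.≤-refl {k}) | χ≤-> (ℕ.n<1+n k) | χ≤-> (ℕ.m<n⇒m<1+n (ℕ.n<1+n k))
        | δ-≡ (suc k) | δ-≢ {k} ℕ.1+n≢n = refl
...   | inj₁ J<k
  rewrite χ≤-> J<k | χ≤-> J<k+1 | χ≤-> (ℕ.m<n⇒m<1+n J<k+1)
        | δ-≢ {suc J} (ℕ.<⇒≢ (ℕ.s<s J<k) ∘ sym) | δ-≢ {J} (ℕ.<⇒≢ J<k+1 ∘ sym) = refl

pathDiv-cong : ∀ {L g g'} → (∀ i → i ≤ L → g i ≡ g' i) →
               ∀ j → j < L → pathDiv g j ≡ pathDiv g' j
pathDiv-cong {g = g} {g'} eq j j<L =
  cong₂ _+_ (cong₂ _-_ (eq (pred j) (ℕ.≤-trans (ℕ.pred[n]≤n {j}) (ℕ.<⇒≤ j<L))) (eq j (ℕ.<⇒≤ j<L)))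
            (cong₂ _-_ (eq (suc j) j<L) (eq j (ℕ.<⇒≤ j<L)))

pathDiv-reverse : ∀ L g j → 1 ≤ j → j < L → pathDiv (λ i → g (L ∸ i)) j ≡ pathDiv g (L ∸ j)
pathDiv-reverse L g (suc k) _ k+1<L =
  begin
    (g (L ∸ k) - g (L ∸ suc k)) + (g (L ∸ suc (suc k)) - g (L ∸ suc k))
  ≡⟨ ℤ.+-comm (g (L ∸ k) - g (L ∸ suc k)) _ ⟩
    (g (L ∸ suc (suc k)) - g (L ∸ suc k)) + (g (L ∸ k) - g (L ∸ suc k))
  ≡⟨ cong₂ (λ p s → (g p - g (L ∸ suc k)) + (g s - g (L ∸ suc k)))
           (sym (ℕ.pred[m∸n]≡m∸[1+n] L (suc k))) (ℕ.+-∸-assoc 1 (ℕ.<⇒≤ k+1<L)) ⟩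
    pathDiv g (L ∸ suc k)
  ∎
  where open ≡-Reasoning

≢1⇒≡0 : ∀ {c : ℤ} → c ≡ 0ℤ ⊎ c ≡ 1ℤ → c ≢ 1ℤ → c ≡ 0ℤ
≢1⇒≡0 (inj₁ c≡0) _    = c≡0
≢1⇒≡0 (inj₂ c≡1) c≢1 = ⊥-elim (c≢1 c≡1)

if-T : ∀ {b} → T b → (if b then 1ℤ else 0ℤ) ≡ 1ℤ
if-T {true} _ = refl

if-¬T : ∀ {b} → ¬ T b → (if b then 1ℤ else 0ℤ) ≡ 0ℤ
if-¬T {false} _  = refl
if-¬T {true}  ¬t = ⊥-elim (¬t _)

PathAdmissible : ℕ → (ℕ → ℤ) → Set
PathAdmissible L c =
  (∀ j → 1 ≤ j → j < L → c j ≡ 0ℤ ⊎ c j ≡ 1ℤ) ×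
  (∀ j j' → 1 ≤ j → j < L → 1 ≤ j' → j' < L → c j ≡ 1ℤ → c j' ≡ 1ℤ → j ≡ j')

PathAdmissible-cong : ∀ {L c c'} → (∀ j → 1 ≤ j → j < L → c j ≡ c' j) →
                      PathAdmissible L c → PathAdmissible L c'
PathAdmissible-cong eq (chips , unique) =
  (λ j 1≤j j<L → Sum.map (trans (sym (eq j 1≤j j<L))) (trans (sym (eq j 1≤j j<L))) (chips j 1≤j j<L)) ,
  (λ j j' 1≤j j<L 1≤j' j'<L c'j≡1 c'j'≡1 →
     unique j j' 1≤j j<L 1≤j' j'<L (trans (eq j 1≤j j<L) c'j≡1) (trans (eq j' 1≤j' j'<L) c'j'≡1))

reverse-interior : ∀ {L j} → 1 ≤ j → j < L → 1 ≤ L ∸ j × L ∸ j < L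
reverse-interior {L} {j} 1≤j j<L = ℕ.m<n⇒0<n∸m j<L , ℕ.∸-monoʳ-< {L} {j} {0} 1≤j (ℕ.<⇒≤ j<L)

PathAdmissible-reverse : ∀ {L c} → PathAdmissible L c → PathAdmissible L (λ j → c (L ∸ j))
PathAdmissible-reverse {L} (chips , unique) =
  (λ j 1≤j j<L → let (1≤j* , j*<L) = reverse-interior 1≤j j<L in chips (L ∸ j) 1≤j* j*<L) ,
  (λ j j' 1≤j j<L 1≤j' j'<L cj≡1 cj'≡1 →
     let (1≤j* , j*<L)   = reverse-interior 1≤j j<L
         (1≤j'* , j'*<L) = reverse-interior 1≤j' j'<L
     in ℕ.∸-cancelˡ-≡ (ℕ.<⇒≤ j<L) (ℕ.<⇒≤ j'<L) (unique _ _ 1≤j* j*<L 1≤j'* j'*<L cj≡1 cj'≡1))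

δ-admissible : ∀ L a → PathAdmissible L (δ a)
δ-admissible L a = (λ j _ _ → zero-or-one j) , (λ j j' _ _ _ _ δj≡1 δj'≡1 → trans (δ-≡1 δj≡1) (sym (δ-≡1 δj'≡1)))
  where
  zero-or-one : ∀ j → δ a j ≡ 0ℤ ⊎ δ a j ≡ 1ℤ
  zero-or-one j with j ℕ.≟ a
  ... | yes _ = inj₂ refl
  ... | no _  = inj₁ refl

summation-by-parts : ∀ L h k →
  (ℤ.+ L - ℤ.+ k) * (h (suc k) - h k) + h k ≡
  (ℤ.+ L * (h 1 - h 0) + h 0) + ∑ (λ j → (ℤ.+ L - ℤ.+ j) * pathDiv h j) (applyUpTo suc k)
summation-by-parts L h zero = base (ℤ.+ L) (h 1 - h 0) (h 0)
  where
  base : ∀ l s h₀ → (l - 0ℤ) * s + h₀ ≡ (l * s + h₀) + 0ℤ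
  base = solve-∀
summation-by-parts L h (suc k) =
  begin
    (ℤ.+ L - ℤ.+ suc k) * (h (2 ℕ.+ k) - h (suc k)) + h (suc k)
  ≡⟨ step (ℤ.+ L) (ℤ.+ k) (h k) (h (suc k)) (h (2 ℕ.+ k)) ⟩
    ((ℤ.+ L - ℤ.+ k) * (h (suc k) - h k) + h k) + φ (suc k)
  ≡⟨ cong (_+ φ (suc k)) (summation-by-parts L h k) ⟩
    (A + ∑ φ (applyUpTo suc k)) + φ (suc k)
  ≡⟨ ℤ.+-assoc A _ _ ⟩
    A + (∑ φ (applyUpTo suc k) + φ (suc k))
  ≡⟨ cong (λ s → A + (∑ φ (applyUpTo suc k) + s)) (sym (ℤ.+-identityʳ _)) ⟩
    A + (∑ φ (applyUpTo suc k) + ∑ φ [ suc k ])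
  ≡⟨ cong (A +_) (sym (∑-++ φ (applyUpTo suc k) [ suc k ])) ⟩
    A + ∑ φ (applyUpTo suc k ++ [ suc k ])
  ≡⟨ cong (λ js → A + ∑ φ js) (applyUpTo-∷ʳ suc k) ⟩
    A + ∑ φ (applyUpTo suc (suc k))
  ∎
  where
  open ≡-Reasoning
  A : ℤ
  A = ℤ.+ L * (h 1 - h 0) + h 0
  φ : ℕ → ℤ
  φ j = (ℤ.+ L - ℤ.+ j) * pathDiv h j
  step : ∀ l k h₀ h₁ h₂ → (l - (1ℤ + k)) * (h₂ - h₁) + h₁ ≡
         ((l - k) * (h₁ - h₀) + h₀) + (l - (1ℤ + k)) * ((h₀ - h₁) + (h₂ - h₁))
  step = solve-∀

weight : ℕ → ℕ → ℕ
weight L zero    = 0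
weight L (suc a) = L ∸ suc a

weight-< : ∀ {L a} → a < L → weight L a < L
weight-< {a = zero}  0<L   = 0<L
weight-< {L} {suc a} a<L = ℕ.∸-monoʳ-< {L} {suc a} {0} (s≤s z≤n) (ℕ.<⇒≤ a<L)

weight-injective : ∀ {L a b} → a < L → b < L → weight L a ≡ weight L b → a ≡ b
weight-injective {a = zero}  {zero}  _   _   _  = refl
weight-injective {a = zero}  {suc b} _   b<L eq = ⊥-elim (ℕ.<⇒≢ (ℕ.m<n⇒0<n∸m b<L) eq)
weight-injective {a = suc a} {zero}  a<L _   eq = ⊥-elim (ℕ.<⇒≢ (ℕ.m<n⇒0<n∸m a<L) (sym eq))
weight-injective {a = suc a} {suc b} a<L b<L eq = ℕ.∸-cancelˡ-≡ (ℕ.<⇒≤ a<L) (ℕ.<⇒≤ b<L) eq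

∑-weighted-δ : ∀ L' a → a < suc L' →
               ∑ (λ j → (ℤ.+ suc L' - ℤ.+ j) * δ a j) (applyUpTo suc L') ≡ ℤ.+ weight (suc L') a
∑-weighted-δ L' zero    _   = ∑-zero vanish
  where
  vanish : ∀ {j} → j ∈ applyUpTo suc L' → (ℤ.+ suc L' - ℤ.+ j) * δ 0 j ≡ 0ℤ
  vanish j∈ with ∈-applyUpTo⁻ suc j∈
  ... | i , _ , refl = ℤ.*-zeroʳ (ℤ.+ suc L' - ℤ.+ suc i)
∑-weighted-δ L' (suc a) a<L =
  begin
    ∑ φ (applyUpTo suc L')
  ≡⟨ ∑-single (applyUpTo⁺₁ suc L' (λ i<j _ → ℕ.<⇒≢ i<j ∘ ℕ.suc-injective))
              (∈-applyUpTo⁺ suc (ℕ.≤-pred a<L)) support ⟩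
    (ℤ.+ suc L' - ℤ.+ suc a) * δ (suc a) (suc a)
  ≡⟨ cong ((ℤ.+ suc L' - ℤ.+ suc a) *_) (δ-≡ (suc a)) ⟩
    (ℤ.+ suc L' - ℤ.+ suc a) * 1ℤ
  ≡⟨ ℤ.*-identityʳ _ ⟩
    ℤ.+ suc L' - ℤ.+ suc a
  ≡⟨ ℤ.m-n≡m⊖n (suc L') (suc a) ⟩
    suc L' ℤ.⊖ suc a
  ≡⟨ ℤ.⊖-≥ (ℕ.<⇒≤ a<L) ⟩
    ℤ.+ weight (suc L') (suc a)
  ∎
  where
  open ≡-Reasoning
  φ : ℕ → ℤ
  φ j = (ℤ.+ suc L' - ℤ.+ j) * δ (suc a) j
  support : ∀ j → φ j ≡ 0ℤ ⊎ j ≡ suc a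
  support j with j ℕ.≟ suc a
  ... | yes j≡a = inj₂ j≡a
  ... | no _    = inj₁ (ℤ.*-zeroʳ (ℤ.+ suc L' - ℤ.+ j))

small-multiple≡0 : ∀ {L p q} x → p < L → q < L → ℤ.+ L * x ≡ ℤ.+ p - ℤ.+ q → x ≡ 0ℤ
small-multiple≡0 {L} {p} {q} x p<L q<L eq =
  ℤ.∣i∣≡0⇒i≡0 (ℕ.n<1⇒n≡0 (ℕ.*-cancelˡ-< L ∣ x ∣ 1 L∣x∣<L*1))
  where
  open ℕ.≤-Reasoning
  L∣x∣<L*1 : L ℕ.* ∣ x ∣ < L ℕ.* 1
  L∣x∣<L*1 = begin-strict
    L ℕ.* ∣ x ∣         ≡⟨ ℤ.abs-* (ℤ.+ L) x ⟨
    ∣ ℤ.+ L * x ∣       ≡⟨ cong ∣_∣ (trans eq (ℤ.m-n≡m⊖n p q)) ⟩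
    ∣ p ℤ.⊖ q ∣         ≤⟨ ℤ.∣m⊝n∣≤m⊔n p q ⟩
    p ℕ.⊔ q             <⟨ ℕ.⊔-lub p<L q<L ⟩
    L                   ≡⟨ ℕ.*-identityʳ L ⟨
    L ℕ.* 1             ∎

harmonic-vanishes : ∀ {L h} → h 0 ≡ 0ℤ → h 1 ≡ 0ℤ → (∀ j → 1 ≤ j → j < L → pathDiv h j ≡ 0ℤ) →
                    ∀ i → i ≤ L → h i ≡ 0ℤ
harmonic-vanishes         h₀ h₁ harmonic zero    _   = h₀
harmonic-vanishes {L} {h} h₀ h₁ harmonic (suc k) k<L = proj₂ (consecutive k k<L)
  where
  consecutive : ∀ k → k < L → h k ≡ 0ℤ × h (suc k) ≡ 0ℤ
  consecutive zero    _     = h₀ , h₁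
  consecutive (suc k) k+1<L with consecutive k (ℕ.<-trans (ℕ.n<1+n k) k+1<L)
  ... | hₖ , hₖ₊₁ = hₖ₊₁ ,
    (begin
      h (2 ℕ.+ k)                                      ≡⟨ simplify (h (2 ℕ.+ k)) ⟨
      (0ℤ - 0ℤ) + (h (2 ℕ.+ k) - 0ℤ)                   ≡⟨ cong₂ (λ a b → (a - b) + (h (2 ℕ.+ k) - b)) hₖ hₖ₊₁ ⟨
      pathDiv h (suc k)                                 ≡⟨ harmonic (suc k) (s≤s z≤n) k+1<L ⟩
      0ℤ                                                ∎)
    where
    open ≡-Reasoning
    simplify : ∀ y → (0ℤ - 0ℤ) + (y - 0ℤ) ≡ y
    simplify = solve-∀

first-moment : ∀ L' h →
  h (suc L') ≡ (ℤ.+ suc L' * (h 1 - h 0) + h 0) + ∑ (λ j → (ℤ.+ suc L' - ℤ.+ j) * pathDiv h j) (applyUpTo suc L')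
first-moment L' h = trans (sym (last-step (ℤ.+ L') (h L') (h (suc L')))) (summation-by-parts (suc L') h L')
  where
  last-step : ∀ k x y → ((1ℤ + k) - k) * (y - x) + x ≡ y
  last-step = solve-∀

∑-weighted-chips : ∀ {L' h a b} → a < suc L' → b < suc L' →
  (∀ j → 1 ≤ j → j < suc L' → pathDiv h j ≡ δ a j - δ b j) →
  ∑ (λ j → (ℤ.+ suc L' - ℤ.+ j) * pathDiv h j) (applyUpTo suc L') ≡ ℤ.+ weight (suc L') a - ℤ.+ weight (suc L') b
∑-weighted-chips {L'} {h} {a} {b} a<L b<L div-h =
  begin
    ∑ (λ j → w j * pathDiv h j) (applyUpTo suc L')
  ≡⟨ ∑-cong (λ j∈ → on-interior (∈-applyUpTo⁻ suc j∈)) ⟩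
    ∑ (λ j → w j * δ a j - w j * δ b j) (applyUpTo suc L')
  ≡⟨ ∑-- _ _ (applyUpTo suc L') ⟩
    ∑ (λ j → w j * δ a j) (applyUpTo suc L') - ∑ (λ j → w j * δ b j) (applyUpTo suc L')
  ≡⟨ cong₂ _-_ (∑-weighted-δ L' a a<L) (∑-weighted-δ L' b b<L) ⟩
    ℤ.+ weight (suc L') a - ℤ.+ weight (suc L') b
  ∎
  where
  open ≡-Reasoning
  w : ℕ → ℤ
  w j = ℤ.+ suc L' - ℤ.+ j
  distrib : ∀ c x y → c * (x - y) ≡ c * x - c * y
  distrib = solve-∀
  on-interior : ∀ {j} → ∃ (λ i → i < L' × j ≡ suc i) → w j * pathDiv h j ≡ w j * δ a j - w j * δ b j
  on-interior (i , i<L' , refl) =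
    trans (cong (w (suc i) *_) (div-h (suc i) (s≤s z≤n) (s≤s i<L'))) (distrib (w (suc i)) (δ a (suc i)) (δ b (suc i)))

chip-difference-vanishes : ∀ {L h a b} → a < L → b < L → h 0 ≡ 0ℤ → h L ≡ 0ℤ →
                           (∀ j → 1 ≤ j → j < L → pathDiv h j ≡ δ a j - δ b j) →
                           h 1 ≡ 0ℤ × a ≡ b
chip-difference-vanishes {suc L'} {h} {a} {b} a<L b<L h₀ hₗ div-h = h₁≡0 , a≡b
  where
  open ≡-Reasoning
  l wa wb : ℤ
  l = ℤ.+ suc L'
  wa = ℤ.+ weight (suc L') a
  wb = ℤ.+ weight (suc L') b
  rearrange : ∀ l x p q → l * x ≡ ((l * (x - 0ℤ) + 0ℤ) + (p - q)) + (q - p)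
  rearrange = solve-∀
  Lh₁≡wb-wa : l * h 1 ≡ wb - wa
  Lh₁≡wb-wa =
    begin
      l * h 1
    ≡⟨ rearrange l (h 1) wa wb ⟩
      ((l * (h 1 - 0ℤ) + 0ℤ) + (wa - wb)) + (wb - wa)
    ≡⟨ cong₂ (λ z s → ((l * (h 1 - z) + z) + s) + (wb - wa)) h₀ (∑-weighted-chips {h = h} a<L b<L div-h) ⟨
      ((l * (h 1 - h 0) + h 0) + ∑ (λ j → (l - ℤ.+ j) * pathDiv h j) (applyUpTo suc L')) + (wb - wa)
    ≡⟨ cong (_+ (wb - wa)) (trans (sym (first-moment L' h)) hₗ) ⟩
      0ℤ + (wb - wa)
    ≡⟨ ℤ.+-identityˡ _ ⟩
      wb - wa
    ∎
  h₁≡0 : h 1 ≡ 0ℤ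
  h₁≡0 = small-multiple≡0 (h 1) (weight-< b<L) (weight-< a<L) Lh₁≡wb-wa
  a≡b : a ≡ b
  a≡b = sym (weight-injective b<L a<L (ℤ.+-injective (ℤ.i-j≡0⇒i≡j wb wa
          (trans (sym Lh₁≡wb-wa) (trans (cong (l *_) h₁≡0) (ℤ.*-zeroʳ l))))))

path-extension-unique : ∀ {L} (d f g : ℕ → ℤ) {a b} → a < L → b < L →
  (∀ j → 1 ≤ j → j < L → d j + pathDiv f j ≡ δ a j) →
  (∀ j → 1 ≤ j → j < L → d j + pathDiv g j ≡ δ b j) →
  f 0 ≡ g 0 → f L ≡ g L → ∀ i → i ≤ L → f i ≡ g i
path-extension-unique {L} d f g {a} {b} a<L b<L chips-f chips-g f₀≡g₀ fₗ≡gₗ i i≤L =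
  ℤ.i-j≡0⇒i≡j (f i) (g i) (harmonic-vanishes {h = h} (ℤ.i≡j⇒i-j≡0 f₀≡g₀) h₁≡0 harmonic i i≤L)
  where
  h : ℕ → ℤ
  h i = f i - g i
  div-h : ∀ j → 1 ≤ j → j < L → pathDiv h j ≡ δ a j - δ b j
  div-h j 1≤j j<L =
    trans (difference (d j) (f (pred j)) (f j) (f (suc j)) (g (pred j)) (g j) (g (suc j)))
          (cong₂ _-_ (chips-f j 1≤j j<L) (chips-g j 1≤j j<L))
    where
    difference : ∀ d f₀ f₁ f₂ g₀ g₁ g₂ →
      ((f₀ - g₀) - (f₁ - g₁)) + ((f₂ - g₂) - (f₁ - g₁)) ≡
      (d + ((f₀ - f₁) + (f₂ - f₁))) - (d + ((g₀ - g₁) + (g₂ - g₁)))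
    difference = solve-∀
  h₁≡0×a≡b : h 1 ≡ 0ℤ × a ≡ b
  h₁≡0×a≡b = chip-difference-vanishes {h = h} a<L b<L (ℤ.i≡j⇒i-j≡0 f₀≡g₀) (ℤ.i≡j⇒i-j≡0 fₗ≡gₗ) div-h
  h₁≡0 : h 1 ≡ 0ℤ
  h₁≡0 = proj₁ h₁≡0×a≡b
  harmonic : ∀ j → 1 ≤ j → j < L → pathDiv h j ≡ 0ℤ
  harmonic j 1≤j j<L =
    trans (div-h j 1≤j j<L) (trans (cong (λ c → δ c j - δ b j) (proj₂ h₁≡0×a≡b)) (ℤ.+-inverseʳ (δ b j)))

-- The subdivision H

module Subdivided (G : Graph) (ℓ : Fin (Graph.m G) → ℕ) (ℓ≥1 : ∀ e → 1 ≤ ℓ e) where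
  open Graph G
  open Subdivision G ℓ

  pos-beyond : ∀ {e r} → ℓ e ≤ r → pos e r ≡ inj₁ (tgt e)
  pos-beyond {e} {zero}  ℓ≤0 = ⊥-elim (ℕ.<⇒≱ (ℓ≥1 e) ℓ≤0)
  pos-beyond {e} {suc k} ℓ≤r with k <? (ℓ e ∸ 1)
  ... | yes k<ℓ-1 = ⊥-elim (ℕ.<⇒≱ k<ℓ-1 (ℕ.∸-monoˡ-≤ 1 ℓ≤r))
  ... | no _      = refl

  pos-interior : ∀ {e r} → 1 ≤ r → r < ℓ e → ∃ λ k → pos e r ≡ inj₂ (e , k)
  pos-interior {e} {suc k} _ r<ℓ with k <? (ℓ e ∸ 1)
  ... | yes _    = _ , refl
  ... | no k≮ℓ-1 = ⊥-elim (k≮ℓ-1 (ℕ.∸-monoˡ-≤ 1 r<ℓ))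

  pos-inj₂ : ∀ {e r e' k} → pos e r ≡ inj₂ (e' , k) → e ≡ e' × r ≡ suc (toℕ k)
  pos-inj₂ {e} {suc j} eq with j <? (ℓ e ∸ 1)
  pos-inj₂ {e} {suc j} refl | yes j<ℓ-1 = refl , cong suc (sym (toℕ-fromℕ< j<ℓ-1))

  pos-injective : ∀ {e r} e' r' → 1 ≤ r → r < ℓ e → pos e r ≡ pos e' r' → e ≡ e' × r ≡ r'
  pos-injective _ _ 1≤r r<ℓ eq with pos-interior 1≤r r<ℓ
  ... | k , pos≡ with pos-inj₂ pos≡ | pos-inj₂ (trans (sym eq) pos≡)
  ... | _ , r≡k+1 | e'≡e , r'≡k+1 = sym e'≡e , trans r≡k+1 (sym r'≡k+1)

  headO : OEdge → Fin n
  headO (e , true)  = tgt e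
  headO (e , false) = src e

  rev : OEdge → OEdge
  rev (e , b) = e , not b

  tailO-rev : ∀ o → tailO (rev o) ≡ headO o
  tailO-rev (e , true)  = refl
  tailO-rev (e , false) = refl

  tailO≢headO : ∀ o → tailO o ≢ headO o
  tailO≢headO (e , true)  = loopless e
  tailO≢headO (e , false) = loopless e ∘ sym

  x-zero : ∀ o → x o 0 ≡ inj₁ (tailO o)
  x-zero (e , true)  = refl
  x-zero (e , false) = pos-beyond ℕ.≤-refl

  x-len : ∀ o → x o (len o) ≡ inj₁ (headO o)
  x-len (e , true)  = pos-beyond ℕ.≤-refl
  x-len (e , false) = cong (pos e) (ℕ.n∸n≡0 (ℓ e))

  x-rev : ∀ o {i} → i ≤ len o → x (rev o) (len o ∸ i) ≡ x o i
  x-rev (e , true)  i≤ℓ = cong (pos e) (ℕ.m∸[m∸n]≡n i≤ℓ)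
  x-rev (e , false) _   = refl

  x-interior : ∀ o {j} → 1 ≤ j → j < len o → ∃ λ k → x o j ≡ inj₂ (proj₁ o , k)
  x-interior (e , true)  1≤j j<ℓ = pos-interior 1≤j j<ℓ
  x-interior (e , false) 1≤j j<ℓ = pos-interior (proj₁ (reverse-interior 1≤j j<ℓ)) (proj₂ (reverse-interior 1≤j j<ℓ))

  x-meet : ∀ o o' {i i'} → 1 ≤ i → i < len o → i' ≤ len o' → x o i ≡ x o' i' → (o' ≡ o × i' ≡ i) ⊎ o' ≡ rev o
  x-meet (e , true) (e' , true) {i' = i'} 1≤i i<ℓ _ eq with pos-injective e' i' 1≤i i<ℓ eq
  ... | refl , i≡i' = inj₁ (refl , sym i≡i')
  x-meet (e , true) (e' , false) {i' = i'} 1≤i i<ℓ _ eq with pos-injective e' (ℓ e' ∸ i') 1≤i i<ℓ eq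
  ... | refl , _ = inj₂ refl
  x-meet (e , false) (e' , true) {i' = i'} 1≤i i<ℓ _ eq with reverse-interior 1≤i i<ℓ
  ... | 1≤i* , i*<ℓ with pos-injective e' i' 1≤i* i*<ℓ eq
  ...   | refl , _ = inj₂ refl
  x-meet (e , false) (e' , false) {i' = i'} 1≤i i<ℓ i'≤ℓ eq with reverse-interior 1≤i i<ℓ
  ... | 1≤i* , i*<ℓ with pos-injective e' (ℓ e' ∸ i') 1≤i* i*<ℓ eq
  ...   | refl , eq* = inj₁ (refl , sym (ℕ.∸-cancelˡ-≡ (ℕ.<⇒≤ i<ℓ) i'≤ℓ eq*))

  outflow inflow : (HV → ℤ) → HV → HV × HV → ℤ
  outflow F w (a , b) = if w == a then F b - F a else 0ℤ
  inflow  F w (a , b) = if w == b then F a - F b else 0ℤ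

  div-flows : ∀ F w → div F w ≡ ∑ (outflow F w) HEdges + ∑ (inflow F w) HEdges
  div-flows F w = foldr≡∑+∑ (outflow F w) (inflow F w) HEdges

  segment : Fin m → ℕ → HV × HV
  segment e i = pos e i , pos e (suc i)

  ∑-HEdges : ∀ φ → ∑ φ HEdges ≡ ∑ (λ e → ∑ (φ ∘ segment e) (upTo (ℓ e))) (allFin m)
  ∑-HEdges φ = trans (∑-concat-map φ _ (allFin m)) (∑-cong {xs = allFin m} (λ {e} _ → ∑-map φ (segment e) (upTo (ℓ e))))

  ∑-HEdges-cong : ∀ {φ ψ} → (∀ e i → i < ℓ e → φ (segment e i) ≡ ψ (segment e i)) → ∑ φ HEdges ≡ ∑ ψ HEdges
  ∑-HEdges-cong {φ} {ψ} eq =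
    trans (∑-HEdges φ)
          (trans (∑-cong {xs = allFin m} λ {e} _ → ∑-cong {xs = upTo (ℓ e)} λ i∈ → eq e _ (∈-upTo⁻ i∈))
                 (sym (∑-HEdges ψ)))

  ∑-HEdges-single : ∀ φ {e₀ i₀} → i₀ < ℓ e₀ → (∀ e i → φ (segment e i) ≡ 0ℤ ⊎ e ≡ e₀ × i ≡ i₀) →
                    ∑ φ HEdges ≡ φ (segment e₀ i₀)
  ∑-HEdges-single φ {e₀} {i₀} i₀<ℓ supp =
    trans (∑-HEdges φ)
          (trans (∑-single (allFin⁺ m) (∈-allFin e₀) outer) (∑-single (upTo⁺ (ℓ e₀)) (∈-upTo⁺ i₀<ℓ) inner))
    where
    outer : ∀ e → ∑ (φ ∘ segment e) (upTo (ℓ e)) ≡ 0ℤ ⊎ e ≡ e₀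
    outer e with e ≟ᶠ e₀
    ... | yes e≡e₀ = inj₂ e≡e₀
    ... | no e≢e₀  =
      inj₁ (∑-zero {xs = upTo (ℓ e)} λ {i} _ → Sum.[ (λ φ≡0 → φ≡0) , (λ (e≡e₀ , _) → ⊥-elim (e≢e₀ e≡e₀)) ] (supp e i))
    inner : ∀ i → φ (segment e₀ i) ≡ 0ℤ ⊎ i ≡ i₀
    inner i = Sum.map₂ proj₂ (supp e₀ i)

  div-cong : ∀ {F F'} → (∀ e i → i ≤ ℓ e → F (pos e i) ≡ F' (pos e i)) → ∀ w → div F w ≡ div F' w
  div-cong {F} {F'} eq w =
    begin
      div F w
    ≡⟨ div-flows F w ⟩
      ∑ (outflow F w) HEdges + ∑ (inflow F w) HEdges
    ≡⟨ cong₂ _+_ (∑-HEdges-cong out) (∑-HEdges-cong in′) ⟩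
      ∑ (outflow F' w) HEdges + ∑ (inflow F' w) HEdges
    ≡⟨ div-flows F' w ⟨
      div F' w
    ∎
    where
    open ≡-Reasoning
    out : ∀ e i → i < ℓ e → outflow F w (segment e i) ≡ outflow F' w (segment e i)
    out e i i<ℓ = cong₂ (λ a b → if w == pos e i then b - a else 0ℤ) (eq e i (ℕ.<⇒≤ i<ℓ)) (eq e (suc i) i<ℓ)
    in′ : ∀ e i → i < ℓ e → inflow F w (segment e i) ≡ inflow F' w (segment e i)
    in′ e i i<ℓ = cong₂ (λ a b → if w == pos e (suc i) then a - b else 0ℤ) (eq e i (ℕ.<⇒≤ i<ℓ)) (eq e (suc i) i<ℓ)

  ==-refl : ∀ w → (w == w) ≡ true
  ==-refl w with w ≟H w
  ... | yes _   = refl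
  ... | no w≢w = ⊥-elim (w≢w refl)

  outflow-at : ∀ F w b → outflow F w (w , b) ≡ F b - F w
  outflow-at F w b rewrite ==-refl w = refl

  inflow-at : ∀ F w a → inflow F w (a , w) ≡ F a - F w
  inflow-at F w a rewrite ==-refl w = refl

  div-pos : ∀ F {e r} → 1 ≤ r → r < ℓ e → div F (pos e r) ≡ pathDiv (F ∘ pos e) r
  div-pos F {e} {suc k} 1≤r r<ℓ =
    begin
      div F w
    ≡⟨ div-flows F w ⟩
      ∑ (outflow F w) HEdges + ∑ (inflow F w) HEdges
    ≡⟨ cong₂ _+_ (∑-HEdges-single (outflow F w) r<ℓ out-support)
                 (∑-HEdges-single (inflow F w) (ℕ.<-trans (ℕ.n<1+n k) r<ℓ) in-support) ⟩
      outflow F w (w , pos e (2 ℕ.+ k)) + inflow F w (pos e k , w)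
    ≡⟨ cong₂ _+_ (outflow-at F w _) (inflow-at F w _) ⟩
      (F (pos e (2 ℕ.+ k)) - F w) + (F (pos e k) - F w)
    ≡⟨ ℤ.+-comm (F (pos e (2 ℕ.+ k)) - F w) _ ⟩
      pathDiv (F ∘ pos e) (suc k)
    ∎
    where
    open ≡-Reasoning
    w : HV
    w = pos e (suc k)
    out-support : ∀ e' i → outflow F w (segment e' i) ≡ 0ℤ ⊎ e' ≡ e × i ≡ suc k
    out-support e' i with w ≟H pos e' i
    ... | yes w≡ = let (e≡e' , k+1≡i) = pos-injective e' i 1≤r r<ℓ w≡
                   in inj₂ (sym e≡e' , sym k+1≡i)
    ... | no _   = inj₁ refl
    in-support : ∀ e' i → inflow F w (segment e' i) ≡ 0ℤ ⊎ e' ≡ e × i ≡ k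
    in-support e' i with w ≟H pos e' (suc i)
    ... | yes w≡ = let (e≡e' , k+1≡i+1) = pos-injective e' (suc i) 1≤r r<ℓ w≡
                   in inj₂ (sym e≡e' , sym (ℕ.suc-injective k+1≡i+1))
    ... | no _   = inj₁ refl

  div-x : ∀ F o {j} → 1 ≤ j → j < len o → div F (x o j) ≡ pathDiv (F ∘ x o) j
  div-x F (e , true)  1≤j j<ℓ = div-pos F 1≤j j<ℓ
  div-x F (e , false) {j} 1≤j j<ℓ =
    trans (div-pos F (proj₁ (reverse-interior 1≤j j<ℓ)) (proj₂ (reverse-interior 1≤j j<ℓ)))
          (sym (pathDiv-reverse (ℓ e) (F ∘ pos e) j 1≤j j<ℓ))

  firstOr0-spec : ∀ p xs → (firstOr0 p xs ≡ 0 × ∀ {j} → j ∈ xs → ¬ T (p j)) ⊎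
                           (firstOr0 p xs ∈ xs × T (p (firstOr0 p xs)))
  firstOr0-spec p [] = inj₁ (refl , λ ())
  firstOr0-spec p (j ∷ js) with p j in pj
  ... | true  = inj₂ (here refl , subst T (sym pj) _)
  ... | false with firstOr0-spec p js
  ...   | inj₁ (≡0 , none)    = inj₁ (≡0 , λ { (here refl) → subst T pj ; (there j∈) → none j∈ })
  ...   | inj₂ (∈js , found) = inj₂ (there ∈js , found)

  -- The chip of c on the interior of a path, with 0 standing for no chip (δ 0 vanishes on the interior).
  chip : ℕ → (ℕ → ℤ) → ℕ
  chip L c = firstOr0 (λ j → ⌊ c j ℤ.≟ 1ℤ ⌋) (map suc (upTo (L ∸ 1)))

  interior⇒∈ : ∀ {L j} → 1 ≤ j → j < L → j ∈ map suc (upTo (L ∸ 1))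
  interior⇒∈ {suc L} {suc i} _ (s≤s i<L) = ∈-map⁺ suc (∈-upTo⁺ i<L)

  ∈⇒interior : ∀ {L j} → j ∈ map suc (upTo (L ∸ 1)) → 1 ≤ j × j < L
  ∈⇒interior {suc L} j∈ with ∈-map⁻ suc j∈
  ... | i , i∈ , refl = s≤s z≤n , s≤s (∈-upTo⁻ i∈)

  chip-spec : ∀ {L} c → 1 ≤ L → PathAdmissible L c →
              chip L c < L × (∀ j → 1 ≤ j → j < L → c j ≡ δ (chip L c) j)
  chip-spec {L} c 1≤L (chips , unique)
    with firstOr0-spec (λ j → ⌊ c j ℤ.≟ 1ℤ ⌋) (map suc (upTo (L ∸ 1)))
  ... | inj₁ (J≡0 , none) rewrite J≡0 =
    1≤L , λ j 1≤j j<L → trans (≢1⇒≡0 (chips j 1≤j j<L) (none (interior⇒∈ 1≤j j<L) ∘ fromWitness))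
                              (sym (δ-≢ (ℕ.<⇒≢ 1≤j ∘ sym)))
  ... | inj₂ (J∈ , found) =
    J<L , at
    where
    J : ℕ
    J = chip L c
    cJ≡1 : c J ≡ 1ℤ
    cJ≡1 = toWitness found
    1≤J : 1 ≤ J
    1≤J = proj₁ (∈⇒interior {L} J∈)
    J<L : J < L
    J<L = proj₂ (∈⇒interior {L} J∈)
    at : ∀ j → 1 ≤ j → j < L → c j ≡ δ J j
    at j 1≤j j<L with j ℕ.≟ J
    ... | yes refl = cJ≡1
    ... | no j≢J  = ≢1⇒≡0 (chips j 1≤j j<L)
                      (λ cj≡1 → j≢J (unique j J 1≤j j<L 1≤J J<L cj≡1 cJ≡1))

  Admissible⇒PathAdmissible : ∀ D → Admissible D → ∀ o → PathAdmissible (len o) (D ∘ x o)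
  Admissible⇒PathAdmissible D (chips , unique) o = chips o , unique o

  PathAdmissible⇒Admissible : ∀ D → (∀ o → PathAdmissible (len o) (D ∘ x o)) → Admissible D
  PathAdmissible⇒Admissible D adm = (λ o → proj₁ (adm o)) , (λ o → proj₂ (adm o))

  chip-along : ∀ D → Admissible D → ∀ o →
               jO D o < len o × (∀ j → 1 ≤ j → j < len o → D (x o j) ≡ δ (jO D o) j)
  chip-along D adm o = chip-spec (D ∘ x o) (ℓ≥1 (proj₁ o)) (Admissible⇒PathAdmissible D adm o)

  χ-≡ : ∀ {v u} → u ≡ v → χ v u ≡ 1ℤ
  χ-≡ {v} {u} u≡v with u ≟ᶠ v
  ... | yes _   = refl
  ... | no u≢v = ⊥-elim (u≢v u≡v)

  χ-≢ : ∀ {v u} → u ≢ v → χ v u ≡ 0ℤ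
  χ-≢ {v} {u} u≢v with u ≟ᶠ v
  ... | yes u≡v = ⊥-elim (u≢v u≡v)
  ... | no _    = refl

  ∈-allOEdges : ∀ o → o ∈ allOEdges
  ∈-allOEdges (e , true)  = ∈-concat⁺′ (here refl) (∈-map⁺ _ (∈-allFin e))
  ∈-allOEdges (e , false) = ∈-concat⁺′ (there (here refl)) (∈-map⁺ _ (∈-allFin e))

  module _ (D : Divisor) (adm : Admissible D) (v : Fin n) where

    InC : HV → Set
    InC w = ∃₂ λ o i → tailO o ≡ v × i ≤ jO D o × w ≡ x o i

    onC : HV → OEdge → Bool
    onC w o = ⌊ tailO o ≟ᶠ v ⌋ ∧ any (λ i → w == x o i) (upTo (suc (jO D o)))

    χC-in : ∀ {w} → InC w → χC D v w ≡ 1ℤ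
    χC-in {w} (o , i , tail≡v , i≤J , w≡) =
      if-T (any⁺ (onC w) (lose (∈-allOEdges o) (Equivalence.from T-∧ (fromWitness tail≡v , on-o))))
      where
      on-o : T (any (λ i → w == x o i) (upTo (suc (jO D o))))
      on-o = any⁺ (λ i → w == x o i) (lose (∈-upTo⁺ (s≤s i≤J)) (fromWitness w≡))

    χC-out : ∀ {w} → ¬ InC w → χC D v w ≡ 0ℤ
    χC-out {w} ∉C = if-¬T λ w∈C →
      let (o , _ , hit)    = find (any⁻ (onC w) allOEdges w∈C)
          (tail≡v , on-o) = Equivalence.to T-∧ hit
          (i , i∈ , w≡)   = find (any⁻ (λ i → w == x o i) (upTo (suc (jO D o))) on-o)
      in ∉C (o , i , toWitness tail≡v , ℕ.≤-pred (∈-upTo⁻ i∈) , toWitness w≡)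

    χC-vertex : ∀ {u} → u ≢ v → χC D v (inj₁ u) ≡ 0ℤ
    χC-vertex {u} u≢v = χC-out ∉C
      where
      ∉C : ¬ InC (inj₁ u)
      ∉C (o , zero , tail≡v , _ , u≡) = u≢v (trans (inj₁-injective (trans u≡ (x-zero o))) tail≡v)
      ∉C (o , suc i , _ , i<J , u≡) with x-interior o (s≤s z≤n) (ℕ.≤-<-trans i<J (proj₁ (chip-along D adm o)))
      ... | _ , x≡ with trans u≡ x≡
      ... | ()

    InC-interior : ∀ o {i} → headO o ≢ v → 1 ≤ i → i < len o → InC (x o i) → tailO o ≡ v × i ≤ jO D o
    InC-interior o head≢v 1≤i i<L (o' , i' , tail'≡v , i'≤J , eq)
      with x-meet o o' 1≤i i<L (ℕ.<⇒≤ (ℕ.≤-<-trans i'≤J (proj₁ (chip-along D adm o')))) eq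
    ... | inj₁ (refl , refl) = tail'≡v , i'≤J
    ... | inj₂ refl          = ⊥-elim (head≢v (trans (sym (tailO-rev o)) tail'≡v))

    χC-outgoing : ∀ o → tailO o ≡ v → ∀ i → i ≤ len o → χC D v (x o i) ≡ χ≤ (jO D o) i
    χC-outgoing o tail≡v i i≤L with ℕ.≤-<-connex i (jO D o)
    ... | inj₁ i≤J = trans (χC-in (o , i , tail≡v , i≤J , refl)) (sym (χ≤-≤ i≤J))
    ... | inj₂ J<i = trans beyond (sym (χ≤-> J<i))
      where
      head≢v : headO o ≢ v
      head≢v head≡v = tailO≢headO o (trans tail≡v (sym head≡v))
      beyond : χC D v (x o i) ≡ 0ℤ
      beyond with ℕ.m≤n⇒m<n∨m≡n i≤L
      ... | inj₁ i<L = χC-out (ℕ.<⇒≱ J<i ∘ proj₂ ∘ InC-interior o head≢v (ℕ.≤-trans (s≤s z≤n) J<i) i<L)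
      ... | inj₂ i≡L = trans (cong (χC D v) (trans (cong (x o) i≡L) (x-len o))) (χC-vertex head≢v)

    χC-away : ∀ o → tailO o ≢ v → headO o ≢ v → ∀ i → i ≤ len o → χC D v (x o i) ≡ 0ℤ
    χC-away o tail≢v head≢v zero    _   = trans (cong (χC D v) (x-zero o)) (χC-vertex tail≢v)
    χC-away o tail≢v head≢v (suc i) i<L with ℕ.m≤n⇒m<n∨m≡n i<L
    ... | inj₁ i+1<L = χC-out (tail≢v ∘ proj₁ ∘ InC-interior o head≢v (s≤s z≤n) i+1<L)
    ... | inj₂ i+1≡L = trans (cong (χC D v) (trans (cong (x o) i+1≡L) (x-len o))) (χC-vertex head≢v)

    M-along : ∀ o {j} → 1 ≤ j → j < len o → M D v (x o j) ≡ D (x o j) + pathDiv (χC D v ∘ x o) j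
    M-along o {j} 1≤j j<L = cong (D (x o j) +_) (div-x (χC D v) o 1≤j j<L)

    M-outgoing : ∀ o → tailO o ≡ v → ∀ j → 1 ≤ j → j < len o → M D v (x o j) ≡ δ (suc (jO D o)) j
    M-outgoing o tail≡v j 1≤j j<L =
      begin
        M D v (x o j)
      ≡⟨ M-along o 1≤j j<L ⟩
        D (x o j) + pathDiv (χC D v ∘ x o) j
      ≡⟨ cong₂ _+_ (proj₂ (chip-along D adm o) j 1≤j j<L) (pathDiv-cong (χC-outgoing o tail≡v) j j<L) ⟩
        δ J j + pathDiv (χ≤ J) j
      ≡⟨ cong (δ J j +_) (pathDiv-χ≤ J j 1≤j) ⟩
        δ J j + (δ (suc J) j - δ J j)
      ≡⟨ cancel (δ J j) (δ (suc J) j) ⟩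
        δ (suc J) j
      ∎
      where
      open ≡-Reasoning
      J : ℕ
      J = jO D o
      cancel : ∀ a b → a + (b - a) ≡ b
      cancel = solve-∀

    M-away : ∀ o → tailO o ≢ v → headO o ≢ v → ∀ j → 1 ≤ j → j < len o → M D v (x o j) ≡ D (x o j)
    M-away o tail≢v head≢v j 1≤j j<L =
      trans (M-along o 1≤j j<L)
            (trans (cong (D (x o j) +_) (pathDiv-cong {g' = λ _ → 0ℤ} (χC-away o tail≢v head≢v) j j<L)) (ℤ.+-identityʳ _))

    M-admissible-outgoing : ∀ o → tailO o ≡ v → PathAdmissible (len o) (M D v ∘ x o)
    M-admissible-outgoing o tail≡v =
      PathAdmissible-cong (λ j 1≤j j<L → sym (M-outgoing o tail≡v j 1≤j j<L)) (δ-admissible (len o) (suc (jO D o)))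

    M-admissible : Admissible (M D v)
    M-admissible = PathAdmissible⇒Admissible (M D v) along
      where
      along : ∀ o → PathAdmissible (len o) (M D v ∘ x o)
      along o with tailO o ≟ᶠ v | headO o ≟ᶠ v
      ... | yes tail≡v | _          = M-admissible-outgoing o tail≡v
      ... | no _       | yes head≡v =
        PathAdmissible-cong (λ j _ j<L → cong (M D v) (x-rev o (ℕ.<⇒≤ j<L)))
                            (PathAdmissible-reverse (M-admissible-outgoing (rev o) (trans (tailO-rev o) head≡v)))
      ... | no tail≢v  | no head≢v  =
        PathAdmissible-cong (λ j 1≤j j<L → sym (M-away o tail≢v head≢v j 1≤j j<L)) (Admissible⇒PathAdmissible D adm o)

    module _ (F : HV → ℤ) (extends : Extends F (χ v)) (admF : Admissible (λ w → D w + div F w)) where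

      χC≡F-at-vertex : ∀ {u} → u ≢ v → χC D v (inj₁ u) ≡ F (inj₁ u)
      χC≡F-at-vertex {u} u≢v = trans (χC-vertex u≢v) (sym (trans (extends u) (χ-≢ u≢v)))

      χC≡F-along : ∀ o → headO o ≢ v → ∀ i → i ≤ len o → χC D v (x o i) ≡ F (x o i)
      χC≡F-along o head≢v =
        path-extension-unique (D ∘ x o) (χC D v ∘ x o) (F ∘ x o)
          (proj₁ (chip-along (M D v) M-admissible o)) (proj₁ (chip-along (λ w → D w + div F w) admF o))
          chips-χC chips-F at-tail at-head
        where
        chips-χC : ∀ j → 1 ≤ j → j < len o → D (x o j) + pathDiv (χC D v ∘ x o) j ≡ δ (jO (M D v) o) j
        chips-χC j 1≤j j<L = trans (sym (M-along o 1≤j j<L)) (proj₂ (chip-along (M D v) M-admissible o) j 1≤j j<L)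
        chips-F : ∀ j → 1 ≤ j → j < len o → D (x o j) + pathDiv (F ∘ x o) j ≡ δ (jO (λ w → D w + div F w) o) j
        chips-F j 1≤j j<L = trans (cong (D (x o j) +_) (sym (div-x F o 1≤j j<L)))
                                 (proj₂ (chip-along (λ w → D w + div F w) admF o) j 1≤j j<L)
        at-tail : χC D v (x o 0) ≡ F (x o 0)
        at-tail with tailO o ≟ᶠ v
        ... | yes tail≡v = trans (χC-in (o , 0 , tail≡v , z≤n , refl))
                                 (sym (trans (cong F (x-zero o)) (trans (extends _) (χ-≡ tail≡v))))
        ... | no tail≢v  = subst (λ w → χC D v w ≡ F w) (sym (x-zero o)) (χC≡F-at-vertex tail≢v)
        at-head : χC D v (x o (len o)) ≡ F (x o (len o))
        at-head = subst (λ w → χC D v w ≡ F w) (sym (x-len o)) (χC≡F-at-vertex head≢v)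

      χC≡F : ∀ e i → i ≤ ℓ e → χC D v (pos e i) ≡ F (pos e i)
      χC≡F e i i≤ℓ with tgt e ≟ᶠ v
      ... | no tgt≢v  = χC≡F-along (e , true) tgt≢v i i≤ℓ
      ... | yes tgt≡v =
        subst (λ r → χC D v (pos e r) ≡ F (pos e r)) (ℕ.m∸[m∸n]≡n i≤ℓ)
              (χC≡F-along (e , false) (λ src≡v → loopless e (trans src≡v (sym tgt≡v))) (ℓ e ∸ i) (ℕ.m∸n≤m (ℓ e) i))

      M-canonical : ∀ w → M D v w ≡ D w + div F w
      M-canonical w = cong (D w +_) (div-cong {χC D v} {F} χC≡F w)

proposition2p13 : (G : Graph) → Connected G → (ℓ : Fin (Graph.m G) → ℕ) → (∀ e → 1 ≤ ℓ e) →
    (D : Subdivision.Divisor G ℓ) → Subdivision.Admissible G ℓ D → (v : Fin (Graph.n G)) →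
    Subdivision.Admissible G ℓ (Subdivision.M G ℓ D v) ×
    ((F : Subdivision.HV G ℓ → ℤ) → Subdivision.Extends G ℓ F (Subdivision.χ G ℓ v) →
      Subdivision.Admissible G ℓ (λ w → D w + Subdivision.div G ℓ F w) →
      ∀ w → Subdivision.M G ℓ D v w ≡ D w + Subdivision.div G ℓ F w)
proposition2p13 G _ ℓ ℓ≥1 D adm v = M-admissible D adm v , M-canonical D adm v
  where open Subdivided G ℓ ℓ≥1
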